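{- Let $n,k,s,t,i$ be positive integers with $t\ge 3$, $(t+1)(k-t+1)\le n$, $t+3\le s\le 2k-t$ and $\max\{t+1,\,s+t-k\}\le i\le \min\{k,\frac{s+t}{2}\}$. Define \[ T_2=(s+t-i)(n-k-i+t+1)+(i-t)(k-s-t+i+1). \] Then $T_2+s(k+i-s-t+1)\le s(n-s+1)$. -}

module Defs where

open import Data.Nat using (ℕ)
open import Data.Integer using (ℤ; +_; _+_; _-_; _*_)

-- T₂ = (s+t-i)(n-k-i+t+1) + (i-t)(k-s-t+i+1), computed in ℤ (no truncated subtraction)
T₂ : ℕ → ℕ → ℕ → ℕ → ℕ → ℤ
T₂ n k s t i =
  ((+ s) + (+ t) - (+ i)) * ((+ n) - (+ k) - (+ i) + (+ t) + + 1)
  + ((+ i) - (+ t)) * ((+ k) - (+ s) - (+ t) + (+ i) + + 1)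

-- Write i = t + a, k = t + m, s = t + 2a + d and n = (t + 1)(m + 1) + e. The hypotheses make
-- a ≥ 1, d, e ≥ 0 and m ≥ 2 (from s + t ≤ k + i and 2i ≤ s + t we get s + t ≤ 2k, while
-- s ≥ t + 3). In these coordinates the right-hand side minus the left-hand side is the
-- polynomial a((t - 1)m + d + e) - (t + a + d), and since (t - 1)m ≥ 2(t - 1) ≥ t + 1 for t ≥ 3
-- it is at least a(t + 1 + d) - (t + a + d) = (a - 1)(t + d) ≥ 0.
module Submission where

open import Defs
open import Data.Integer as ℤ using (+_)
open import Data.Integer.Properties using (pos-*)
open import Data.List using (_∷_; [])
open import Data.Product using (∃-syntax; _×_; _,_)
open import Relation.Binary.PropositionalEquality
  using (_≡_; refl; sym; trans; cong; subst; subst₂)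

module _ where
  open import Data.Integer using (ℤ; 1ℤ; _+_; _-_; _*_; _≤_; +≤+; nonNegative)
  open import Data.Integer.Properties using (i≤i+j; i≤j⇒0≤j-i; ≤-trans; ≤-reflexive)
  open import Data.Integer.Tactic.RingSolver using (solve)
  open import Data.Nat as ℕ using ()

  gap-identity : ∀ {n} (t a m d e : ℤ) → n ≡ (t + 1ℤ) * (m + 1ℤ) + e →
    let i = t + a
        k = t + m
        s = t + a + a + d
    in s * (n - s + 1ℤ)
       ≡ (s + t - i) * (n - k - i + t + 1ℤ) + (i - t) * (k - s - t + i + 1ℤ)
         + s * (k + i - s - t + 1ℤ)
         + (a * (t * m + d + e) - (t + a + d + a * m))
  gap-identity t a m d e refl = solve (t ∷ a ∷ m ∷ d ∷ e ∷ [])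

  ≤-by-slack : ∀ {l r x y} → r ≡ l + (x - y) → y ≤ x → l ≤ r
  ≤-by-slack {l} {x = x} {y} r≡l+[x-y] y≤x =
    ≤-trans (i≤i+j l (x - y) {{nonNegative (i≤j⇒0≤j-i y≤x)}}) (≤-reflexive (sym r≡l+[x-y]))

  slack-cast : ∀ t a m d e →
    t ℕ.+ a ℕ.+ d ℕ.+ a ℕ.* m ℕ.≤ a ℕ.* (t ℕ.* m ℕ.+ d ℕ.+ e) →
    + t + + a + + d + + a * + m ≤ + a * (+ t * + m + + d + + e)
  slack-cast t a m d e y≤x =
    subst₂ _≤_ (cong (_+_ (+ (t ℕ.+ a ℕ.+ d))) (pos-* a m))
               (trans (pos-* a _) (cong (λ tm → + a * (tm + + d + + e)) (pos-* t m)))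
               (+≤+ y≤x)

open import Data.Nat using (ℕ; _≤_; _<_; _+_; _*_; _∸_; NonZero; s≤s)
open import Data.Nat.Properties
  using ( ≤-trans; m≤m+n; m≤n+m∸n; +-mono-≤; +-monoˡ-≤; +-monoʳ-≤; +-monoˡ-<; +-monoʳ-<
        ; +-cancelʳ-≤; *-cancelˡ-<; n<1+n; +-assoc; +-suc; m+n∸m≡n; m≤n⇒∃[o]m+o≡n
        ; module ≤-Reasoning )
open import Data.Nat.Tactic.RingSolver using (solve)

m∸n≤o⇒m≤n+o : ∀ m n {o} → m ∸ n ≤ o → m ≤ n + o
m∸n≤o⇒m≤n+o m n m∸n≤o = ≤-trans (m≤n+m∸n m n) (+-monoʳ-≤ n m∸n≤o)

m+n+o∸m≡n+o : ∀ m n o → m + n + o ∸ m ≡ n + o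
m+n+o∸m≡n+o m n o = trans (cong (_∸ m) (+-assoc m n o)) (m+n∸m≡n m (n + o))

m+n≤o⇒∃[p]n≤p×m+p≡o : ∀ m {n o} → m + n ≤ o → ∃[ p ] n ≤ p × m + p ≡ o
m+n≤o⇒∃[p]n≤p×m+p≡o m {n} m+n≤o with q , refl ← m≤n⇒∃[o]m+o≡n m+n≤o =
  n + q , m≤m+n n q , sym (+-assoc m n q)

m≤n+o⇒2o≤m⇒m≤2n : ∀ {m n o} → m ≤ n + o → 2 * o ≤ m → m ≤ 2 * n
m≤n+o⇒2o≤m⇒m≤2n {m} {n} {o} m≤n+o 2o≤m = +-cancelʳ-≤ m m (2 * n) (begin
  m + m             ≤⟨ +-mono-≤ m≤n+o m≤n+o ⟩
  n + o + (n + o)   ≡⟨ solve (n ∷ o ∷ []) ⟩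
  2 * n + 2 * o     ≤⟨ +-monoʳ-≤ (2 * n) 2o≤m ⟩
  2 * n + m         ∎)
  where open ≤-Reasoning

t+2≤k : ∀ k s t {i} → s + t ∸ k ≤ i → 2 * i ≤ s + t → t + 3 ≤ s → t + 2 ≤ k
t+2≤k k s t {i} s+t∸k≤i 2i≤s+t t+3≤s =
  subst (_≤ k) (sym (+-suc t 1)) (*-cancelˡ-< 2 (t + 1) k 2[t+1]<2k)
  where
  open ≤-Reasoning
  2[t+1]<2k : 2 * (t + 1) < 2 * k
  2[t+1]<2k = begin-strict
    2 * (t + 1)   ≡⟨ solve (t ∷ []) ⟩
    t + 2 + t     <⟨ +-monoˡ-< t (+-monoʳ-< t (n<1+n 2)) ⟩
    t + 3 + t     ≤⟨ +-monoˡ-≤ t t+3≤s ⟩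
    s + t         ≤⟨ m≤n+o⇒2o≤m⇒m≤2n {n = k} {o = i} (m∸n≤o⇒m≤n+o (s + t) k s+t∸k≤i) 2i≤s+t ⟩
    2 * k         ∎

2[t+a]≤s+t⇒t+a+a≤s : ∀ s t a → 2 * (t + a) ≤ s + t → t + a + a ≤ s
2[t+a]≤s+t⇒t+a+a≤s s t a 2[t+a]≤s+t = +-cancelʳ-≤ t (t + a + a) s (begin
  t + a + a + t   ≡⟨ solve (t ∷ a ∷ []) ⟩
  2 * (t + a)     ≤⟨ 2[t+a]≤s+t ⟩
  s + t           ∎)
  where open ≤-Reasoning

-- a((t - 1)m + d + e) ≥ t + a + d, with a·m moved across so that no subtraction occurs.
slack-bound : ∀ {t a m} d e → 3 ≤ t → 1 ≤ a → 2 ≤ m → t + a + d + a * m ≤ a * (t * m + d + e)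
slack-bound d e (s≤s (s≤s (s≤s {n = T} _))) (s≤s {n = A} _) (s≤s (s≤s {n = M} _)) = begin
  (3 + T) + (1 + A) + d + (1 + A) * (2 + M)
    ≤⟨ m≤m+n _ _ ⟩
  (3 + T) + (1 + A) + d + (1 + A) * (2 + M)
    + (T + (2 + T) * M + e + A * (3 + 2 * T + (2 + T) * M + d + e))
    ≡⟨ solve (T ∷ A ∷ M ∷ d ∷ e ∷ []) ⟩
  (1 + A) * ((3 + T) * (2 + M) + d + e)
    ∎
  where open ≤-Reasoning

lemma3p6 : (n k s t i : ℕ) → .{{_ : NonZero n}} → .{{_ : NonZero k}} → .{{_ : NonZero s}} → .{{_ : NonZero t}} → .{{_ : NonZero i}} →
    3 ≤ t → (t + 1) * ((k + 1) ∸ t) ≤ n → t + 3 ≤ s → s ≤ 2 * k ∸ t →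
    t + 1 ≤ i → (s + t) ∸ k ≤ i → i ≤ k → 2 * i ≤ s + t →
    (T₂ n k s t i ℤ.+ (+ s) ℤ.* ((+ k) ℤ.+ (+ i) ℤ.- (+ s) ℤ.- (+ t) ℤ.+ + 1)) ℤ.≤ (+ s) ℤ.* ((+ n) ℤ.- (+ s) ℤ.+ + 1)
lemma3p6 n k s t i 3≤t n-bound t+3≤s _ t+1≤i s+t∸k≤i _ 2i≤s+t
  with m , 2≤m , refl ← m+n≤o⇒∃[p]n≤p×m+p≡o t (t+2≤k k s t s+t∸k≤i 2i≤s+t t+3≤s)
     | a , 1≤a , refl ← m+n≤o⇒∃[p]n≤p×m+p≡o t t+1≤i
  with d , refl ← m≤n⇒∃[o]m+o≡n (2[t+a]≤s+t⇒t+a+a≤s s t a 2i≤s+t)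
  with e , refl ← m≤n⇒∃[o]m+o≡n (subst (λ x → (t + 1) * x ≤ n) (m+n+o∸m≡n+o t m 1) n-bound)
  = ≤-by-slack (gap-identity (+ t) (+ a) (+ m) (+ d) (+ e) (cong (ℤ._+ + e) (pos-* (t + 1) (m + 1))))
               (slack-cast t a m d e (slack-bound d e 3≤t 1≤a 2≤m))
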